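{- Let $m\ge 1$, let $h$ be a positive integer, and let $\lambda=(\lambda_1,\ldots,\lambda_m)$ be a partition with at most $m$ parts. Let $\deg G_{h,\lambda}(\mathbf{x})=|\lambda|+N$, and let $\lambda^{(0)},\ldots,\lambda^{(N)}$ be the sequence of dominating partitions for $G_{h,\lambda}(\mathbf{x})$. Then: (a) for each $k=0,\ldots,N$, the partition $\lambda^{(k)}$ dominates every partition $\mu\in A(h,\lambda)$ with $|\mu|=|\lambda|+k$; (b) $\lambda^{(N)}$ is the unique partition of $|\lambda|+N$ in $A(h,\lambda)$; (c) $A(h,\lambda)=\{\mu \mid \lambda\subseteq\mu\subseteq\lambda^{(N)}\}$, where $\mu$ ranges over partitions with at most $m$ parts and $\subseteq$ denotes containment of Young diagrams.
   Context: Partitions $\lambda=(\lambda_1\ge\cdots\ge\lambda_m\ge 0)$ with $|\lambda|=\sum\lambda_i$; Young diagrams have $\lambda_i$ left-justified boxes in row $i$. For partitions $\mu\supseteq\lambda$, $\mu/\lambda$ is the skew shape of boxes of $\mu$ not in $\lambda$. The Schur polynomial is $s_\mu(x_1,\ldots,x_m)=\sum_T \mathbf{x}^T$, summed over semistandard Young tableaux $T$ of shape $\mu$ with entries in $\{1,\ldots,m\}$ (rows weakly increasing, columns strictly increasing), where $\mathbf{x}^T=\prod_i x_i^{(\#\text{ of } i \text{ in } T)}$. Inflated symmetric Grothendieck polynomial: for a positive integer $h$ and a partition $\mu\supseteq\lambda$ with at most $m$ rows, let $b_{h,\lambda\mu}$ be the number of fillings of the boxes of $\mu/\lambda$ with positive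 integers that strictly increase along each row and each column, where entries in row $r$ lie in $\{1,\ldots,h(r-1)\}$. Let $A(h,\lambda)=\{\mu\mid b_{h,\lambda\mu}\ne 0\}$ and $G_{h,\lambda}(\mathbf{x})=\sum_{\mu\in A(h,\lambda)}(-1)^{|\mu/\lambda|}b_{h,\lambda\mu}s_\mu(\mathbf{x})$. Dominance: for partitions $\mu,\nu$ of the same integer, $\mu$ dominates $\nu$ if $\mu_1+\cdots+\mu_i\ge\nu_1+\cdots+\nu_i$ for all $i$. Sequence of dominating partitions: $\lambda^{(0)}=\lambda$, and for $k\ge1$, $\lambda^{(k)}$ is obtained from $\lambda^{(k-1)}$ by adding one box in row $r_k$, where $r_k\in\{1,\ldots,m\}$ is the smallest integer such that $\lambda^{(k-1)}_{r_k}-\lambda_{r_k}<h(r_k-1)$ and adding a box in row $r_k$ of $\lambda^{(k-1)}$ yields a partition. If $\deg G_{h,\lambda}=|\lambda|+N$, the sequence $\lambda^{(0)},\ldots,\lambda^{(N)}$ is called the sequence of dominating partitions for $G_{h,\lambda}$. -}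

module Defs where

open import Data.Nat using (ℕ; zero; suc; _+_; _*_; _∸_; _≤_; _<_; _≡ᵇ_; _<ᵇ_; _≤ᵇ_)
open import Data.Bool using (Bool; true; false; _∧_; _∨_; not; if_then_else_)
open import Data.Fin using (Fin; zero; suc; toℕ; inject₁)
open import Data.Vec using (Vec; []; _∷_; lookup; tabulate; _[_]%=_)
import Data.Vec as V
open import Data.List using (List; []; _∷_; map; concatMap; length; filter; upTo; allFin; foldr)
import Data.List as L
open import Data.Bool.ListAction using (and)
open import Data.Integer as Z using (ℤ; -_)
open Z using () renaming (+_ to ⁺_)
open import Data.Product using (_×_; _,_; Σ; ∃; proj₁; proj₂)
open import Data.Maybe using (Maybe; just; nothing; _>>=_)
open import Relation.Binary.PropositionalEquality using (_≡_; _≢_)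
open import Relation.Nullary.Decidable using (T?)
open import Data.Bool using (T)

-- Partitions with at most m parts: weakly decreasing vectors of length m.
-- Row i : Fin m is row r = toℕ i + 1 of the paper (1-indexed).

IsPartition : ∀ {m} → Vec ℕ m → Set
IsPartition {m} v = ∀ (i j : Fin m) → toℕ i ≤ toℕ j → lookup v j ≤ lookup v i

size : ∀ {m} → Vec ℕ m → ℕ
size = V.sum

_⊆ᵖ_ : ∀ {m} → Vec ℕ m → Vec ℕ m → Set
_⊆ᵖ_ {m} la μ = ∀ (i : Fin m) → lookup la i ≤ lookup μ i

psum : ∀ {m} → ℕ → Vec ℕ m → ℕ
psum zero    _        = 0
psum (suc k) []       = 0
psum (suc k) (x ∷ xs) = x + psum k xs

Dominates : ∀ {m} → Vec ℕ m → Vec ℕ m → Set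
Dominates μ ν = size μ ≡ size ν × (∀ (k : ℕ) → psum k ν ≤ psum k μ)

range : ℕ → ℕ → List ℕ
range a b = map (λ x → a + x) (upTo (b ∸ a))

assignAll : ∀ {B : Set} → List B → (B → List ℕ) → List (List (B × ℕ))
assignAll []       opts = [] ∷ []
assignAll (b ∷ bs) opts =
  concatMap (λ rest → map (λ v → (b , v) ∷ rest) (opts b)) (assignAll bs opts)

allPairs : ∀ {A : Set} → List A → (A → A → Bool) → Bool
allPairs xs p = and (concatMap (λ x → map (λ y → p x y) xs) xs)

_⇒ᵇ_ : Bool → Bool → Bool
a ⇒ᵇ b = not a ∨ b

count : ∀ {A : Set} → (A → Bool) → List A → ℕ
count p xs = length (filter (λ x → T? (p x)) xs)

-- boxes (row index, column index), 0-based, of row i between columns [a, b)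
Box = ℕ × ℕ

rowsBoxes : ∀ {m} → (Fin m → ℕ) → (Fin m → ℕ) → List Box
rowsBoxes {m} lo hi =
  concatMap (λ i → map (λ c → (toℕ i , c)) (range (lo i) (hi i))) (allFin m)

-- b_{h,λμ}: number of fillings of μ/λ with positive integers, strictly
-- increasing along rows and columns, entries in row r in {1,…,h(r-1)}.

skewBoxes : ∀ {m} → Vec ℕ m → Vec ℕ m → List Box
skewBoxes la μ = rowsBoxes (lookup la) (lookup μ)

strictOK : (Box × ℕ) → (Box × ℕ) → Bool
strictOK ((r , c) , v) ((r' , c') , v') =
  (((r ≡ᵇ r') ∧ (c <ᵇ c')) ⇒ᵇ (v <ᵇ v')) ∧ (((c ≡ᵇ c') ∧ (r <ᵇ r')) ⇒ᵇ (v <ᵇ v'))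

fillings : ∀ {m} → ℕ → Vec ℕ m → Vec ℕ m → List (List (Box × ℕ))
fillings h la μ =
  filter (λ F → T? (allPairs F strictOK))
         (assignAll (skewBoxes la μ) (λ rc → range 1 (suc (h * proj₁ rc))))

b : ∀ {m} → ℕ → Vec ℕ m → Vec ℕ m → ℕ
b h la μ = length (fillings h la μ)

A : ∀ {m} → ℕ → Vec ℕ m → Vec ℕ m → Set
A h la μ = IsPartition μ × la ⊆ᵖ μ × b h la μ ≢ 0

-- Schur polynomials s_μ(x_1..x_m): coefficient of x^α is the number of
-- SSYT of shape μ, entries in {1..m}, with content α.

ssytOK : (Box × ℕ) → (Box × ℕ) → Bool
ssytOK ((r , c) , v) ((r' , c') , v') =
  (((r ≡ᵇ r') ∧ (c <ᵇ c')) ⇒ᵇ (v ≤ᵇ v')) ∧ (((c ≡ᵇ c') ∧ (r <ᵇ r')) ⇒ᵇ (v <ᵇ v'))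

ssyt : ∀ {m} → Vec ℕ m → List (List (Box × ℕ))
ssyt {m} μ =
  filter (λ T' → T? (allPairs T' ssytOK))
         (assignAll (rowsBoxes (λ _ → 0) (lookup μ)) (λ _ → range 1 (suc m)))

content : ∀ {m} → List (Box × ℕ) → Vec ℕ m
content T' = tabulate (λ j → count (λ e → proj₂ e ≡ᵇ suc (toℕ j)) T')

vecEqᵇ : ∀ {m} → Vec ℕ m → Vec ℕ m → Bool
vecEqᵇ []       []       = true
vecEqᵇ (x ∷ xs) (y ∷ ys) = (x ≡ᵇ y) ∧ vecEqᵇ xs ys

schurCoeff : ∀ {m} → Vec ℕ m → Vec ℕ m → ℕ
schurCoeff μ α = count (λ T' → vecEqᵇ (content T') α) (ssyt μ)

-- G_{h,λ}(x) as its coefficient function on monomials x^α (α ∈ ℕ^m).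
-- Every μ ∈ A(h,λ) satisfies λ_r ≤ μ_r ≤ λ_r + h(r-1), so the sum over
-- A(h,λ) is the sum over the (finitely many) partitions in that box;
-- the ones with b = 0 contribute 0.

vecsBetween : ∀ {m} → Vec ℕ m → Vec ℕ m → List (Vec ℕ m)
vecsBetween []       []       = [] ∷ []
vecsBetween (l ∷ ls) (u ∷ us) =
  concatMap (λ x → map (x ∷_) (vecsBetween ls us)) (range l (suc u))

isPartitionᵇ : ∀ {m} → Vec ℕ m → Bool
isPartitionᵇ []           = true
isPartitionᵇ (x ∷ [])     = true
isPartitionᵇ (x ∷ y ∷ ys) = (y ≤ᵇ x) ∧ isPartitionᵇ (y ∷ ys)

candidates : ∀ {m} → ℕ → Vec ℕ m → List (Vec ℕ m)
candidates h la =
  filter (λ μ → T? (isPartitionᵇ μ))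
         (vecsBetween la (tabulate (λ i → lookup la i + h * toℕ i)))

sgn : ℕ → ℤ
sgn zero    = ⁺ 1
sgn (suc k) = - sgn k

GCoeff : ∀ {m} → ℕ → Vec ℕ m → Vec ℕ m → ℤ
GCoeff h la α =
  foldr Z._+_ (⁺ 0)
    (map (λ μ → sgn (size μ ∸ size la) Z.* (⁺ b h la μ) Z.* (⁺ schurCoeff μ α))
         (candidates h la))

DegG : ∀ {m} → ℕ → Vec ℕ m → ℕ → Set
DegG {m} h la d =
  (Σ (Vec ℕ m) λ α → GCoeff h la α ≢ ⁺ 0 × size α ≡ d)
  × (∀ (α : Vec ℕ m) → GCoeff h la α ≢ ⁺ 0 → size α ≤ d)

addableᵇ : ∀ {m} → Vec ℕ m → Fin m → Bool
addableᵇ ν zero    = true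
addableᵇ ν (suc j) = lookup ν (suc j) <ᵇ lookup ν (inject₁ j)

firstFin : ∀ {m} → (Fin m → Bool) → Maybe (Fin m)
firstFin {zero}  p = nothing
firstFin {suc m} p with p zero
... | true  = just zero
... | false with firstFin {m} (λ i → p (suc i))
...   | just i  = just (suc i)
...   | nothing = nothing

domStep : ∀ {m} → ℕ → Vec ℕ m → Vec ℕ m → Maybe (Vec ℕ m)
domStep h la ν with firstFin (λ i → ((lookup ν i ∸ lookup la i) <ᵇ (h * toℕ i)) ∧ addableᵇ ν i)
... | just i  = just (ν [ i ]%= suc)
... | nothing = nothing

-- λ^(k) (nothing if the defining row r_k fails to exist at some step)
domSeq : ∀ {m} → ℕ → Vec ℕ m → ℕ → Maybe (Vec ℕ m)
domSeq h la zero    = just la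
domSeq h la (suc k) = domSeq h la k >>= domStep h la

-- Row i (counted from 0) of μ/λ admits a strictly increasing filling by {1, …, h·i}
-- exactly when it has at most h·i boxes.  Hence A(h,λ) consists of the partitions
-- between λ and the greatest partition Λ with Λ_i ≤ λ_i + h·i, namely
-- Λ_i = min_{j ≤ i} (λ_j + h·j).  Each s_μ in G_{h,λ} is homogeneous of degree
-- |μ| ≤ |Λ|, and in degree |Λ| all contributions to a coefficient carry the sign
-- (-1)^{|Λ/λ|}, with s_Λ contributing; so deg G_{h,λ} = |Λ|.  The dominating sequence
-- always grows the first row that is not yet full, so every row above a row in which
-- λ^(k) exceeds λ is already a row of Λ; this gives the dominance, and λ^(N) = Λ.

module Submission where

open import Defs
open import Data.Nat using (ℕ; zero; suc; _+_; _*_; _∸_; _≤_; _<_; _≡ᵇ_; _<ᵇ_; _≤ᵇ_; _⊓_; z≤n; s≤s; s≤s⁻¹; z<s)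
open import Data.Nat.Properties
open import Data.Bool using (Bool; true; false; T; _∧_; if_then_else_)
open import Data.Bool.Properties using (T-∧)
open import Data.Bool.ListAction using (and)
open import Data.Unit using (tt)
open import Data.Empty using (⊥-elim)
open import Data.Sum using (_⊎_; inj₁; inj₂)
open import Data.Fin using (Fin; zero; suc; toℕ; inject₁)
open import Data.Fin.Properties using (toℕ-injective; toℕ-inject₁; toℕ<n; any?) renaming (_≟_ to _≟ᶠ_)
open import Data.Vec using (Vec; []; _∷_; lookup; _[_]%=_)
import Data.Vec as V
import Data.Vec.Properties as VP
open import Data.List using (List; []; _∷_; map; concatMap; length; upTo; allFin; foldr)
import Data.List as L
import Data.List.Properties as LP
import Data.Nat.ListAction as NL
open import Data.List.Membership.Propositional using (_∈_; find; lose)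
open import Data.List.Membership.Propositional.Properties
  using (∈-map⁺; ∈-map⁻; ∈-concatMap⁺; ∈-concatMap⁻; ∈-upTo⁺; ∈-upTo⁻; ∈-filter⁺; ∈-filter⁻; ∈-allFin)
open import Data.List.Relation.Unary.Any using (here; there)
open import Data.Maybe using (just; _>>=_)
open import Data.Product using (_×_; _,_; Σ; ∃; proj₁; proj₂; map₂)
open import Data.Integer as Z using (ℤ)
open Z using () renaming (+_ to ⁺_)
import Data.Integer.Properties as ZP
open import Algebra.Properties.CommutativeSemigroup +-commutativeSemigroup using (interchange)
open import Function using (_∘_)
open import Function.Bundles using (_⇔_; mk⇔; Equivalence)
open import Function.Properties.Equivalence using () renaming (trans to ⇔-trans)
open import Relation.Binary.PropositionalEquality
open import Relation.Nullary using (yes; no; _×-dec_)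
open import Relation.Nullary.Decidable using (T?)

open Equivalence using (to; from)

∈-range⁺ : ∀ {a c d} → a ≤ c → c < d → c ∈ range a d
∈-range⁺ {a} {c} {d} a≤c c<d =
  subst (_∈ range a d) (m+[n∸m]≡n a≤c) (∈-map⁺ (a +_) (∈-upTo⁺ (∸-monoˡ-< c<d a≤c)))

m<n∸o⇒o+m<n : ∀ o m n → m < n ∸ o → o + m < n
m<n∸o⇒o+m<n zero    m n       lt = lt
m<n∸o⇒o+m<n (suc o) m zero    ()
m<n∸o⇒o+m<n (suc o) m (suc n) lt = s≤s (m<n∸o⇒o+m<n o m n lt)

∈-range⁻ : ∀ {a c d} → c ∈ range a d → a ≤ c × c < d
∈-range⁻ {a} {c} {d} c∈ with ∈-map⁻ (a +_) c∈
... | x , x∈ , refl = m≤m+n a x , m<n∸o⇒o+m<n a x d (∈-upTo⁻ x∈)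

⇒ᵇ-elim : ∀ {a c} → T (a ⇒ᵇ c) → T a → T c
⇒ᵇ-elim {true} t _ = t

⇒ᵇ-intro : ∀ {a c} → (T a → T c) → T (a ⇒ᵇ c)
⇒ᵇ-intro {true}  f = f tt
⇒ᵇ-intro {false} f = tt

length≢0⇒∃∈ : ∀ {X : Set} (xs : List X) → length xs ≢ 0 → ∃ (_∈ xs)
length≢0⇒∃∈ []      ≢0 = ⊥-elim (≢0 refl)
length≢0⇒∃∈ (x ∷ _) ≢0 = x , here refl

∈⇒length≢0 : ∀ {X : Set} {xs : List X} {x} → x ∈ xs → length xs ≢ 0
∈⇒length≢0 (here _)  ()
∈⇒length≢0 (there _) ()

T-and⁻ : ∀ (bs : List Bool) {c} → T (and bs) → c ∈ bs → T c
T-and⁻ (true ∷ bs) t (here refl) = tt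
T-and⁻ (true ∷ bs) t (there c∈) = T-and⁻ bs t c∈

T-and⁺ : ∀ (bs : List Bool) → (∀ {c} → c ∈ bs → T c) → T (and bs)
T-and⁺ []           all = tt
T-and⁺ (true ∷ bs)  all = T-and⁺ bs (all ∘ there)
T-and⁺ (false ∷ bs) all = all (here refl)

module _ {X : Set} (p : X → X → Bool) where

  private
    pairValues : List X → List Bool
    pairValues xs = concatMap (λ x → map (p x) xs) xs

  allPairs⁻ : ∀ xs {x y} → T (allPairs xs p) → x ∈ xs → y ∈ xs → T (p x y)
  allPairs⁻ xs {x} t x∈ y∈ =
    T-and⁻ (pairValues xs) t (∈-concatMap⁺ (λ x → map (p x) xs) (lose x∈ (∈-map⁺ (p x) y∈)))

  allPairs⁺ : ∀ xs → (∀ {x y} → x ∈ xs → y ∈ xs → T (p x y)) → T (allPairs xs p)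
  allPairs⁺ xs all = T-and⁺ (pairValues xs) pairs
    where
    pairs : ∀ {c} → c ∈ pairValues xs → T c
    pairs c∈ with find (∈-concatMap⁻ (λ x → map (p x) xs) c∈)
    ... | x , x∈ , c∈row with ∈-map⁻ (p x) c∈row
    ... | y , y∈ , refl = all x∈ y∈

module _ {B : Set} (opts : B → List ℕ) where

  ∈-assignAll⁻ : ∀ (bs : List B) {F} → F ∈ assignAll bs opts →
    map proj₁ F ≡ bs × (∀ {e} → e ∈ F → proj₂ e ∈ opts (proj₁ e))
  ∈-assignAll⁻ []       (here refl) = refl , λ ()
  ∈-assignAll⁻ (x ∷ bs) F∈ with find (∈-concatMap⁻ (λ rest → map (λ v → (x , v) ∷ rest) (opts x)) F∈)
  ... | rest , rest∈ , F∈row with ∈-map⁻ (λ v → (x , v) ∷ rest) F∈row | ∈-assignAll⁻ bs rest∈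
  ... | v , v∈ , refl | boxes , valid = cong (x ∷_) boxes , valid′
    where
    valid′ : ∀ {e} → e ∈ (x , v) ∷ rest → proj₂ e ∈ opts (proj₁ e)
    valid′ (here refl) = v∈
    valid′ (there e∈)  = valid e∈

  ∈-assignAll⁺ : ∀ (bs : List B) (f : B → ℕ) → (∀ {x} → x ∈ bs → f x ∈ opts x) →
    map (λ x → (x , f x)) bs ∈ assignAll bs opts
  ∈-assignAll⁺ []       f valid = here refl
  ∈-assignAll⁺ (x ∷ bs) f valid =
    ∈-concatMap⁺ (λ rest → map (λ v → (x , v) ∷ rest) (opts x))
      (lose (∈-assignAll⁺ bs f (valid ∘ there)) (∈-map⁺ (λ v → (x , v) ∷ _) (valid (here refl))))

  assignAll-value : ∀ (bs : List B) {F} → F ∈ assignAll bs opts → ∀ {x} → x ∈ bs →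
    ∃ λ v → (x , v) ∈ F × v ∈ opts x
  assignAll-value bs F∈ x∈ with ∈-assignAll⁻ bs F∈
  ... | boxes , valid with ∈-map⁻ proj₁ (subst (_ ∈_) (sym boxes) x∈)
  ... | (_ , v) , e∈ , refl = v , e∈ , valid e∈

∈-rowsBoxes⁺ : ∀ {m} (lo hi : Fin m → ℕ) (i : Fin m) {c} → lo i ≤ c → c < hi i →
  (toℕ i , c) ∈ rowsBoxes lo hi
∈-rowsBoxes⁺ lo hi i lo≤c c<hi =
  ∈-concatMap⁺ (λ i → map (toℕ i ,_) (range (lo i) (hi i)))
    (lose (∈-allFin i) (∈-map⁺ (toℕ i ,_) (∈-range⁺ lo≤c c<hi)))

∈-rowsBoxes⁻ : ∀ {m} (lo hi : Fin m → ℕ) {r c} → (r , c) ∈ rowsBoxes lo hi →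
  ∃ λ i → r ≡ toℕ i × lo i ≤ c × c < hi i
∈-rowsBoxes⁻ {m} lo hi rc∈
  with find (∈-concatMap⁻ (λ i → map (toℕ i ,_) (range (lo i) (hi i))) {xs = allFin m} rc∈)
... | i , _ , rc∈row with ∈-map⁻ (toℕ i ,_) rc∈row
... | c , c∈ , refl = i , refl , ∈-range⁻ c∈

RowBound : ∀ {m} → ℕ → Vec ℕ m → Vec ℕ m → Set
RowBound h la μ = ∀ i → lookup μ i ≤ lookup la i + h * toℕ i

Bounded : ∀ {m} → ℕ → Vec ℕ m → Vec ℕ m → Set
Bounded h la μ = IsPartition μ × la ⊆ᵖ μ × RowBound h la μ

entryRange : ℕ → Box → List ℕ
entryRange h (r , _) = range 1 (suc (h * r))

module _ {m} (h : ℕ) (la μ : Vec ℕ m) where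

  IsFilling : List (Box × ℕ) → Set
  IsFilling F = F ∈ assignAll (skewBoxes la μ) (entryRange h) × T (allPairs F strictOK)

  ∈-fillings⁻ : ∀ {F} → F ∈ fillings h la μ → IsFilling F
  ∈-fillings⁻ = ∈-filter⁻ (λ F → T? (allPairs F strictOK))

  module _ {F} (isF : IsFilling F) (i : Fin m) where

    private
      entryAt : ∀ j → lookup la i + j < lookup μ i →
        ∃ λ v → ((toℕ i , lookup la i + j) , v) ∈ F × 1 ≤ v × v ≤ h * toℕ i
      entryAt j box<μ
        with assignAll-value (entryRange h) (skewBoxes la μ) (proj₁ isF)
               (∈-rowsBoxes⁺ (lookup la) (lookup μ) i (m≤m+n _ j) box<μ)
      ... | v , e∈ , v∈ with ∈-range⁻ v∈
      ... | 1≤v , v<1+hi = v , e∈ , 1≤v , s≤s⁻¹ v<1+hi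

      rowIncreasing : ∀ {c c' v v'} → ((toℕ i , c) , v) ∈ F → ((toℕ i , c') , v') ∈ F → c < c' → v < v'
      rowIncreasing {c} {c'} {v} {v'} e∈ e'∈ c<c' =
        <ᵇ⇒< v v' (⇒ᵇ-elim (proj₁ (to T-∧ (allPairs⁻ strictOK F (proj₂ isF) e∈ e'∈)))
                            (from T-∧ (≡⇒≡ᵇ (toℕ i) (toℕ i) refl , <⇒<ᵇ c<c')))

    filling-entry> : ∀ j → lookup la i + j < lookup μ i →
      ∃ λ v → ((toℕ i , lookup la i + j) , v) ∈ F × j < v × v ≤ h * toℕ i
    filling-entry> zero box<μ = entryAt zero box<μ
    filling-entry> (suc j) box<μ
      with entryAt (suc j) box<μ | filling-entry> j (<-trans (+-monoʳ-< _ (n<1+n j)) box<μ)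
    ... | v , e∈ , _ , v≤hi | w , w∈ , j<w , _ =
      v , e∈ , ≤-<-trans j<w (rowIncreasing w∈ e∈ (+-monoʳ-< _ (n<1+n j))) , v≤hi

  b≢0⇒rowLength≤ : b h la μ ≢ 0 → ∀ i → lookup μ i ∸ lookup la i ≤ h * toℕ i
  b≢0⇒rowLength≤ b≢0 i with length≢0⇒∃∈ (fillings h la μ) b≢0
  ... | F , F∈ with lookup μ i ∸ lookup la i in rowLength
  ... | zero  = z≤n
  ... | suc j with filling-entry> (∈-fillings⁻ F∈) i j box<μ
    where
    box<μ : lookup la i + j < lookup μ i
    box<μ = begin-strict
      lookup la i + j                           <⟨ +-monoʳ-< _ (n<1+n j) ⟩
      lookup la i + suc j                       ≡⟨ cong (lookup la i +_) rowLength ⟨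
      lookup la i + (lookup μ i ∸ lookup la i)  ≡⟨ m+[n∸m]≡n (<⇒≤ la<μ) ⟩
      lookup μ i                                ∎
      where
      open ≤-Reasoning
      la<μ : lookup la i < lookup μ i
      la<μ = m∸n≢0⇒n<m (λ ≡0 → 1+n≢0 (trans (sym rowLength) ≡0))
  ... | _ , _ , j<v , v≤hi = ≤-trans j<v v≤hi

  b≢0⇒RowBound : b h la μ ≢ 0 → RowBound h la μ
  b≢0⇒RowBound b≢0 i = ≤-trans (m≤n+m∸n (lookup μ i) (lookup la i)) (+-monoʳ-≤ _ (b≢0⇒rowLength≤ b≢0 i))

lookupℕ : ∀ {n} → Vec ℕ n → ℕ → ℕ
lookupℕ []       _       = 0
lookupℕ (x ∷ _)  zero    = x
lookupℕ (_ ∷ xs) (suc r) = lookupℕ xs r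

lookupℕ-toℕ : ∀ {n} (v : Vec ℕ n) (i : Fin n) → lookupℕ v (toℕ i) ≡ lookup v i
lookupℕ-toℕ (x ∷ _)  zero    = refl
lookupℕ-toℕ (_ ∷ xs) (suc i) = lookupℕ-toℕ xs i

module CanonicalFilling {m} (h : ℕ) (h≥1 : 1 ≤ h) (la μ : Vec ℕ m) (μ-bounded : Bounded h la μ) where

  -- Row i of μ/λ has at most h·i boxes, so it can end with the entry h·i;
  -- columns then increase because h ≥ 1 and μ is weakly decreasing.
  entry : Box → ℕ
  entry (r , c) = (h * r + suc c) ∸ lookupℕ μ r

  private
    InSkew : Fin m → ℕ → Set
    InSkew i c = lookup la i ≤ c × c < lookup μ i

    entryAt : Fin m → ℕ → ℕ
    entryAt i c = (h * toℕ i + suc c) ∸ lookup μ i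

    entry-toℕ : ∀ i c → entry (toℕ i , c) ≡ entryAt i c
    entry-toℕ i c = cong ((h * toℕ i + suc c) ∸_) (lookupℕ-toℕ μ i)

    μ≤h*i+c : ∀ {i c} → InSkew i c → lookup μ i ≤ h * toℕ i + c
    μ≤h*i+c {i} {c} (la≤c , _) = begin
      lookup μ i                ≤⟨ proj₂ (proj₂ μ-bounded) i ⟩
      lookup la i + h * toℕ i   ≤⟨ +-monoˡ-≤ _ la≤c ⟩
      c + h * toℕ i             ≡⟨ +-comm c _ ⟩
      h * toℕ i + c             ∎
      where open ≤-Reasoning

    μ≤h*i+1+c : ∀ {i c} → InSkew i c → lookup μ i ≤ h * toℕ i + suc c
    μ≤h*i+1+c sk = ≤-trans (μ≤h*i+c sk) (+-monoʳ-≤ _ (n≤1+n _))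

    entryAt∈entryRange : ∀ {i c} → InSkew i c → entryAt i c ∈ entryRange h (toℕ i , c)
    entryAt∈entryRange {i} {c} sk@(_ , c<μ) = ∈-range⁺
      (m<n⇒0<n∸m (≤-<-trans (μ≤h*i+c sk) (+-monoʳ-< _ (n<1+n c))))
      (s≤s (≤-trans (∸-monoʳ-≤ (h * toℕ i + suc c) c<μ) (≤-reflexive (m+n∸n≡m _ (suc c)))))

    h*-mono-< : ∀ {r r'} → r < r' → h * r < h * r'
    h*-mono-< {r} r<r' = begin-strict
      h * r      <⟨ +-monoˡ-≤ (h * r) h≥1 ⟩
      h + h * r  ≡⟨ *-suc h r ⟨
      h * suc r  ≤⟨ *-monoʳ-≤ h r<r' ⟩
      _          ∎
      where open ≤-Reasoning

    entryAt-strictOK : ∀ {i c i' c'} → InSkew i c → InSkew i' c' →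
      T (strictOK ((toℕ i , c) , entryAt i c) ((toℕ i' , c') , entryAt i' c'))
    entryAt-strictOK {i} {c} {i'} {c'} sk sk' = from T-∧ (⇒ᵇ-intro alongRow , ⇒ᵇ-intro alongColumn)
      where
      alongRow : T ((toℕ i ≡ᵇ toℕ i') ∧ (c <ᵇ c')) → T (entryAt i c <ᵇ entryAt i' c')
      alongRow t with to T-∧ t
      ... | i≡ᵇi' , c<ᵇc' with toℕ-injective (≡ᵇ⇒≡ (toℕ i) (toℕ i') i≡ᵇi')
      ... | refl = <⇒<ᵇ (∸-monoˡ-< (+-monoʳ-< _ (s≤s (<ᵇ⇒< c c' c<ᵇc'))) (μ≤h*i+1+c sk))
      alongColumn : T ((c ≡ᵇ c') ∧ (toℕ i <ᵇ toℕ i')) → T (entryAt i c <ᵇ entryAt i' c')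
      alongColumn t with to T-∧ t
      ... | c≡ᵇc' , i<ᵇi' with ≡ᵇ⇒≡ c c' c≡ᵇc'
      ... | refl = <⇒<ᵇ (begin-strict
        (h * toℕ i + suc c) ∸ lookup μ i    ≤⟨ ∸-monoʳ-≤ _ μi'≤μi ⟩
        (h * toℕ i + suc c) ∸ lookup μ i'   <⟨ ∸-monoˡ-< (+-monoˡ-< (suc c) (h*-mono-< i<i'))
                                                          (≤-trans μi'≤μi (μ≤h*i+1+c sk)) ⟩
        (h * toℕ i' + suc c) ∸ lookup μ i'  ∎)
        where
        open ≤-Reasoning
        i<i' = <ᵇ⇒< (toℕ i) (toℕ i') i<ᵇi'
        μi'≤μi = proj₁ μ-bounded i i' (<⇒≤ i<i')

  filling : List (Box × ℕ)
  filling = map (λ x → (x , entry x)) (skewBoxes la μ)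

  filling-IsFilling : IsFilling h la μ filling
  filling-IsFilling = ∈-assignAll⁺ (entryRange h) (skewBoxes la μ) entry valid , allPairs⁺ strictOK filling strict
    where
    valid : ∀ {x} → x ∈ skewBoxes la μ → entry x ∈ entryRange h x
    valid {r , c} x∈ with ∈-rowsBoxes⁻ (lookup la) (lookup μ) x∈
    ... | i , refl , sk = subst (_∈ entryRange h (toℕ i , c)) (sym (entry-toℕ i c)) (entryAt∈entryRange sk)
    strict : ∀ {x y} → x ∈ filling → y ∈ filling → T (strictOK x y)
    strict x∈ y∈ with ∈-map⁻ (λ x → (x , entry x)) x∈ | ∈-map⁻ (λ x → (x , entry x)) y∈
    ... | (r , c) , x∈′ , refl | (r' , c') , y∈′ , refl
      with ∈-rowsBoxes⁻ (lookup la) (lookup μ) x∈′ | ∈-rowsBoxes⁻ (lookup la) (lookup μ) y∈′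
    ... | i , refl , sk | i' , refl , sk' rewrite entry-toℕ i c | entry-toℕ i' c' = entryAt-strictOK sk sk'

  b≢0 : b h la μ ≢ 0
  b≢0 = ∈⇒length≢0 (∈-filter⁺ (λ F → T? (allPairs F strictOK)) (proj₁ filling-IsFilling) (proj₂ filling-IsFilling))

A⇔Bounded : ∀ {m} (h : ℕ) → 1 ≤ h → (la μ : Vec ℕ m) → A h la μ ⇔ Bounded h la μ
A⇔Bounded h h≥1 la μ = mk⇔
  (λ (μ-partition , la⊆μ , b≢0) → μ-partition , la⊆μ , b≢0⇒RowBound h la μ b≢0)
  (λ μ-bounded@(μ-partition , la⊆μ , _) → μ-partition , la⊆μ , CanonicalFilling.b≢0 h h≥1 la μ μ-bounded)

IsPartition-tail : ∀ {n x} {xs : Vec ℕ n} → IsPartition (x ∷ xs) → IsPartition xs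
IsPartition-tail P i j i≤j = P (suc i) (suc j) (s≤s i≤j)

IsPartition-∷ : ∀ {n x} {xs : Vec ℕ n} → IsPartition xs → (∀ i → lookup xs i ≤ x) → IsPartition (x ∷ xs)
IsPartition-∷ P ≤x zero    zero    _         = ≤-refl
IsPartition-∷ P ≤x zero    (suc j) _         = ≤x j
IsPartition-∷ P ≤x (suc i) (suc j) (s≤s i≤j) = P i j i≤j

IsGreatest : ∀ {m} → ℕ → Vec ℕ m → Vec ℕ m → Set
IsGreatest h la Λ = Bounded h la Λ × (∀ μ → Bounded h la μ → μ ⊆ᵖ Λ)

module _ (h : ℕ) where

  capped : ∀ {n} → ℕ → ℕ → Vec ℕ n → Vec ℕ n
  capped c r []       = []
  capped c r (x ∷ xs) = c ⊓ (x + h * r) ∷ capped (c ⊓ (x + h * r)) (suc r) xs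

  capped-≤ : ∀ {n} c r (v : Vec ℕ n) i → lookup (capped c r v) i ≤ c
  capped-≤ c r (x ∷ xs) zero    = m⊓n≤m c _
  capped-≤ c r (x ∷ xs) (suc i) = ≤-trans (capped-≤ _ (suc r) xs i) (m⊓n≤m c _)

  capped-bound : ∀ {n} c r (v : Vec ℕ n) i → lookup (capped c r v) i ≤ lookup v i + h * (r + toℕ i)
  capped-bound c r (x ∷ xs) zero =
    subst (λ r′ → c ⊓ (x + h * r) ≤ x + h * r′) (sym (+-identityʳ r)) (m⊓n≤n c _)
  capped-bound c r (x ∷ xs) (suc i) =
    subst (λ r′ → lookup (capped (c ⊓ (x + h * r)) (suc r) xs) i ≤ lookup xs i + h * r′) (sym (+-suc r (toℕ i)))
      (capped-bound _ (suc r) xs i)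

  capped-partition : ∀ {n} c r (v : Vec ℕ n) → IsPartition (capped c r v)
  capped-partition c r []       ()
  capped-partition c r (x ∷ xs) = IsPartition-∷ (capped-partition _ (suc r) xs) (capped-≤ _ (suc r) xs)

  capped-greatest : ∀ {n} c r (v μ : Vec ℕ n) → IsPartition μ → (∀ i → lookup μ i ≤ c) →
    (∀ i → lookup μ i ≤ lookup v i + h * (r + toℕ i)) → μ ⊆ᵖ capped c r v
  capped-greatest c r (x ∷ xs) (y ∷ ys) P ≤c ≤bound = head≤ ∷≤ tail≤
    where
    head≤ : y ≤ c ⊓ (x + h * r)
    head≤ = ⊓-glb (≤c zero) (subst (λ r′ → y ≤ x + h * r′) (+-identityʳ r) (≤bound zero))
    tail≤ : ys ⊆ᵖ capped (c ⊓ (x + h * r)) (suc r) xs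
    tail≤ = capped-greatest _ (suc r) xs ys (IsPartition-tail P)
      (λ j → ≤-trans (P zero (suc j) z≤n) head≤)
      (λ j → subst (λ r′ → lookup ys j ≤ lookup xs j + h * r′) (+-suc r (toℕ j)) (≤bound (suc j)))
    _∷≤_ : y ≤ c ⊓ (x + h * r) → ys ⊆ᵖ capped (c ⊓ (x + h * r)) (suc r) xs → (y ∷ ys) ⊆ᵖ capped c r (x ∷ xs)
    (y≤ ∷≤ ys≤) zero    = y≤
    (y≤ ∷≤ ys≤) (suc i) = ys≤ i

  greatestBounded : ∀ {m} → Vec ℕ m → Vec ℕ m
  greatestBounded []         = []
  greatestBounded la@(x ∷ _) = capped x 0 la

  greatestBounded-isGreatest : ∀ {m} (la : Vec ℕ m) → IsPartition la → IsGreatest h la (greatestBounded la)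
  greatestBounded-isGreatest [] _ = ((λ ()) , (λ ()) , λ ()) , λ _ _ ()
  greatestBounded-isGreatest la@(x ∷ _) P =
    (capped-partition x 0 la , capped-greatest x 0 la la P (λ i → P zero i z≤n) (λ i → m≤m+n _ _)
      , capped-bound x 0 la)
    , λ μ (μ-partition , _ , μ-bound) → capped-greatest x 0 la μ μ-partition
        (λ i → ≤-trans (μ-partition zero i z≤n) (≤-trans (μ-bound zero) (≤-reflexive x+h*0≡x))) μ-bound
    where
    x+h*0≡x : x + h * 0 ≡ x
    x+h*0≡x = trans (cong (x +_) (*-zeroʳ h)) (+-identityʳ x)

size-%=suc : ∀ {n} (v : Vec ℕ n) i → size (v [ i ]%= suc) ≡ suc (size v)
size-%=suc (x ∷ xs) zero    = refl
size-%=suc (x ∷ xs) (suc i) = trans (cong (x +_) (size-%=suc xs i)) (+-suc x (size xs))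

lookup-%=suc-≥ : ∀ {n} (v : Vec ℕ n) i j → lookup v j ≤ lookup (v [ i ]%= suc) j
lookup-%=suc-≥ v i j with j ≟ᶠ i
... | yes refl = ≤-trans (n≤1+n _) (≤-reflexive (sym (VP.lookup∘updateAt i v)))
... | no j≢i   = ≤-reflexive (sym (VP.lookup∘updateAt′ j i j≢i v))

size-mono-⊆ᵖ : ∀ {n} (u v : Vec ℕ n) → u ⊆ᵖ v → size u ≤ size v
size-mono-⊆ᵖ []       []       _   = z≤n
size-mono-⊆ᵖ (x ∷ xs) (y ∷ ys) u⊆v = +-mono-≤ (u⊆v zero) (size-mono-⊆ᵖ xs ys (u⊆v ∘ suc))

⊆ᵖ∧size≥⇒≡ : ∀ {n} (u v : Vec ℕ n) → u ⊆ᵖ v → size v ≤ size u → u ≡ v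
⊆ᵖ∧size≥⇒≡ []       []       _   _  = refl
⊆ᵖ∧size≥⇒≡ (x ∷ xs) (y ∷ ys) u⊆v ≥ = cong₂ _∷_ x≡y (⊆ᵖ∧size≥⇒≡ xs ys (u⊆v ∘ suc) ys≤xs)
  where
  xs≤ys = size-mono-⊆ᵖ xs ys (u⊆v ∘ suc)
  x≡y : x ≡ y
  x≡y = ≤-antisym (u⊆v zero) (+-cancelʳ-≤ (size xs) y x (≤-trans (+-monoʳ-≤ y xs≤ys) ≥))
  ys≤xs : size ys ≤ size xs
  ys≤xs = +-cancelˡ-≤ x (size ys) (size xs) (subst (λ z → z + size ys ≤ x + size xs) (sym x≡y) ≥)

tailSum : ∀ {m} → ℕ → Vec ℕ m → ℕ
tailSum zero    v        = size v
tailSum (suc k) []       = 0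
tailSum (suc k) (_ ∷ xs) = tailSum k xs

psum+tailSum : ∀ {m} k (v : Vec ℕ m) → psum k v + tailSum k v ≡ size v
psum+tailSum zero    v        = refl
psum+tailSum (suc k) []       = refl
psum+tailSum (suc k) (x ∷ xs) = trans (+-assoc x (psum k xs) (tailSum k xs)) (cong (x +_) (psum+tailSum k xs))

psum-mono : ∀ {m} k (u v : Vec ℕ m) → (∀ i → toℕ i < k → lookup u i ≤ lookup v i) → psum k u ≤ psum k v
psum-mono zero    u        v        _  = z≤n
psum-mono (suc k) []       []       _  = z≤n
psum-mono (suc k) (x ∷ xs) (y ∷ ys) ≤v = +-mono-≤ (≤v zero z<s) (psum-mono k xs ys (λ i i<k → ≤v (suc i) (s≤s i<k)))

tailSum-mono : ∀ {m} k (u v : Vec ℕ m) → (∀ i → k ≤ toℕ i → lookup u i ≤ lookup v i) → tailSum k u ≤ tailSum k v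
tailSum-mono zero    u        v        ≤v = size-mono-⊆ᵖ u v (λ i → ≤v i z≤n)
tailSum-mono (suc k) []       []       _  = z≤n
tailSum-mono (suc k) (x ∷ xs) (y ∷ ys) ≤v = tailSum-mono k xs ys (λ i k≤i → ≤v (suc i) (s≤s k≤i))

IsPartition-%=suc : ∀ {n} {ν : Vec ℕ n} {i} → IsPartition ν →
  (∀ a → toℕ a < toℕ i → suc (lookup ν i) ≤ lookup ν a) → IsPartition (ν [ i ]%= suc)
IsPartition-%=suc {ν = ν} {i} P room a c a≤c with a ≟ᶠ i | c ≟ᶠ i
... | yes refl | yes refl = ≤-refl
... | yes refl | no c≢a   = subst₂ _≤_ (sym (VP.lookup∘updateAt′ c a c≢a ν)) (sym (VP.lookup∘updateAt a ν))
                              (m≤n⇒m≤1+n (P a c a≤c))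
... | no a≢c   | yes refl = subst₂ _≤_ (sym (VP.lookup∘updateAt c ν)) (sym (VP.lookup∘updateAt′ a c a≢c ν))
                              (room a (≤∧≢⇒< a≤c (a≢c ∘ toℕ-injective)))
... | no a≢i   | no c≢i   = subst₂ _≤_ (sym (VP.lookup∘updateAt′ c i c≢i ν)) (sym (VP.lookup∘updateAt′ a i a≢i ν))
                              (P a c a≤c)

addableᵇ⇒room : ∀ {n} {ν : Vec ℕ n} → IsPartition ν → ∀ i → T (addableᵇ ν i) →
  ∀ a → toℕ a < toℕ i → suc (lookup ν i) ≤ lookup ν a
addableᵇ⇒room P (suc j) addable a a<i =
  ≤-trans (<ᵇ⇒< _ _ addable) (P a (inject₁ j) (≤-trans (s≤s⁻¹ a<i) (≤-reflexive (sym (toℕ-inject₁ j)))))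

canGrow : ∀ {m} → ℕ → Vec ℕ m → Vec ℕ m → Fin m → Bool
canGrow h la ν i = ((lookup ν i ∸ lookup la i) <ᵇ (h * toℕ i)) ∧ addableᵇ ν i

canGrow⇒Bounded : ∀ {m} h (la ν : Vec ℕ m) → Bounded h la ν → ∀ i → T (canGrow h la ν i) →
  Bounded h la (ν [ i ]%= suc)
canGrow⇒Bounded h la ν (ν-partition , la⊆ν , ν-bound) i grow with to T-∧ grow
... | short , addable =
  IsPartition-%=suc {ν = ν} ν-partition (addableᵇ⇒room ν-partition i addable) ,
  (λ j → ≤-trans (la⊆ν j) (lookup-%=suc-≥ ν i j)) ,
  bound
  where
  bound : RowBound h la (ν [ i ]%= suc)
  bound j with j ≟ᶠ i
  ... | yes refl = begin
    lookup (ν [ j ]%= suc) j                        ≡⟨ VP.lookup∘updateAt j ν ⟩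
    suc (lookup ν j)                                ≡⟨ cong suc (m+[n∸m]≡n (la⊆ν j)) ⟨
    suc (lookup la j + (lookup ν j ∸ lookup la j))  ≡⟨ +-suc (lookup la j) _ ⟨
    lookup la j + suc (lookup ν j ∸ lookup la j)    ≤⟨ +-monoʳ-≤ (lookup la j) (<ᵇ⇒< _ _ short) ⟩
    lookup la j + h * toℕ j                         ∎
    where open ≤-Reasoning
  ... | no j≢i = subst (_≤ _) (sym (VP.lookup∘updateAt′ j i j≢i ν)) (ν-bound j)

FirstTrue : ∀ {m} → (Fin m → Bool) → Fin m → Set
FirstTrue p q = T (p q) × (∀ i → toℕ i < toℕ q → p i ≡ false)

firstTrue? : ∀ {m} (p : Fin m → Bool) → (∀ i → p i ≡ false) ⊎ ∃ (FirstTrue p)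
firstTrue? {zero}  p = inj₁ λ ()
firstTrue? {suc m} p with p zero in p0
... | true  = inj₂ (zero , subst T (sym p0) tt , λ _ ())
... | false with firstTrue? (p ∘ suc)
...   | inj₁ none          = inj₁ λ { zero → p0 ; (suc i) → none i }
...   | inj₂ (q , pq , before) = inj₂ (suc q , pq , λ { zero _ → p0 ; (suc i) (s≤s i<q) → before i i<q })

firstFin-FirstTrue : ∀ {m} (p : Fin m → Bool) {q} → FirstTrue p q → firstFin p ≡ just q
firstFin-FirstTrue p {zero} (pq , _) with p zero
... | true = refl
firstFin-FirstTrue p {suc q} (pq , before) with p zero | before zero z<s
... | false | _ rewrite firstFin-FirstTrue (p ∘ suc) {q} (pq , λ i i<q → before (suc i) (s≤s i<q)) = refl

domStep-FirstTrue : ∀ {m} h (la ν : Vec ℕ m) {q} → FirstTrue (canGrow h la ν) q →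
  domStep h la ν ≡ just (ν [ q ]%= suc)
domStep-FirstTrue h la ν first rewrite firstFin-FirstTrue (canGrow h la ν) first = refl

FullAbove : ∀ {m} → Vec ℕ m → Vec ℕ m → Vec ℕ m → Set
FullAbove la Λ ν = ∀ i j → toℕ i < toℕ j → lookup la j < lookup ν j → lookup ν i ≡ lookup Λ i

module DominatingSequence {m} (h : ℕ) (la : Vec ℕ m) (la-partition : IsPartition la)
                          (Λ : Vec ℕ m) (Λ-greatest : IsGreatest h la Λ) where

  private
    Λ-bounded = proj₁ Λ-greatest
    ⊆Λ = proj₂ Λ-greatest

  Invariant : ℕ → Vec ℕ m → Set
  Invariant k ν = Bounded h la ν × FullAbove la Λ ν × size ν ≡ size la + k

  -- the grown partition would be bounded but not contained in Λ
  full⇒¬canGrow : ∀ {ν} → Bounded h la ν → ∀ i → lookup ν i ≡ lookup Λ i → canGrow h la ν i ≡ false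
  full⇒¬canGrow {ν} ν-bounded i full with canGrow h la ν i in grow
  ... | false = refl
  ... | true  = ⊥-elim (1+n≰n (begin
    suc (lookup Λ i)          ≡⟨ cong suc full ⟨
    suc (lookup ν i)          ≡⟨ VP.lookup∘updateAt i ν ⟨
    lookup (ν [ i ]%= suc) i  ≤⟨ ⊆Λ (ν [ i ]%= suc) (canGrow⇒Bounded h la ν ν-bounded i (subst T (sym grow) tt)) i ⟩
    lookup Λ i                ∎))
    where open ≤-Reasoning

  deficit⇒canGrow : ∀ {ν} → Bounded h la ν → ∀ q → lookup ν q < lookup Λ q →
    (∀ i → toℕ i < toℕ q → lookup ν i ≡ lookup Λ i) → T (canGrow h la ν q)
  deficit⇒canGrow {ν} (_ , la⊆ν , _) q ν<Λ full = from T-∧ (short , addable q ν<Λ full)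
    where
    short : T ((lookup ν q ∸ lookup la q) <ᵇ (h * toℕ q))
    short = <⇒<ᵇ (subst (lookup ν q ∸ lookup la q <_) (m+n∸m≡n (lookup la q) _)
      (∸-monoˡ-< (<-≤-trans ν<Λ (proj₂ (proj₂ Λ-bounded) q)) (la⊆ν q)))
    addable : ∀ q → lookup ν q < lookup Λ q → (∀ i → toℕ i < toℕ q → lookup ν i ≡ lookup Λ i) →
      T (addableᵇ ν q)
    addable zero    _   _    = tt
    addable (suc j) ν<Λ full = <⇒<ᵇ (begin-strict
      lookup ν (suc j)     <⟨ ν<Λ ⟩
      lookup Λ (suc j)     ≤⟨ proj₁ Λ-bounded (inject₁ j) (suc j) (≤-trans (≤-reflexive (toℕ-inject₁ j)) (n≤1+n _)) ⟩
      lookup Λ (inject₁ j) ≡⟨ full (inject₁ j) (s≤s (≤-reflexive (toℕ-inject₁ j))) ⟨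
      lookup ν (inject₁ j) ∎)
      where open ≤-Reasoning

  step : ∀ {k ν} → Invariant k ν → size ν < size Λ →
    Σ (Vec ℕ m) λ ν' → domStep h la ν ≡ just ν' × Invariant (suc k) ν'
  step {k} {ν} (ν-bounded , ν-full , ν-size) ν<Λ with firstTrue? (λ i → lookup ν i <ᵇ lookup Λ i)
  ... | inj₁ none = ⊥-elim (<⇒≱ ν<Λ (size-mono-⊆ᵖ Λ ν Λ⊆ν))
    where
    Λ⊆ν : Λ ⊆ᵖ ν
    Λ⊆ν i = ≮⇒≥ (λ lt → subst T (none i) (<⇒<ᵇ lt))
  ... | inj₂ (q , deficit , before) =
    ν [ q ]%= suc ,
    domStep-FirstTrue h la ν (grows , λ i i<q → full⇒¬canGrow ν-bounded i (full i i<q)) ,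
    canGrow⇒Bounded h la ν ν-bounded q grows ,
    full′ ,
    trans (size-%=suc ν q) (trans (cong suc ν-size) (sym (+-suc (size la) k)))
    where
    ν<Λ-at-q = <ᵇ⇒< _ _ deficit
    full : ∀ i → toℕ i < toℕ q → lookup ν i ≡ lookup Λ i
    full i i<q = ≤-antisym (⊆Λ ν ν-bounded i) (≮⇒≥ (λ lt → subst T (before i i<q) (<⇒<ᵇ lt)))
    grows = deficit⇒canGrow ν-bounded q ν<Λ-at-q full
    full′ : FullAbove la Λ (ν [ q ]%= suc)
    full′ i j i<j grown with j ≟ᶠ q
    ... | yes refl = trans (VP.lookup∘updateAt′ i j (λ i≡j → <⇒≢ i<j (cong toℕ i≡j)) ν) (full i i<j)
    ... | no j≢q with i ≟ᶠ q
    ...   | yes refl = ⊥-elim (<⇒≢ ν<Λ-at-q (ν-full i j i<j (subst (_ <_) (VP.lookup∘updateAt′ j i j≢q ν) grown)))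
    ...   | no i≢q   = trans (VP.lookup∘updateAt′ i q i≢q ν)
                             (ν-full i j i<j (subst (_ <_) (VP.lookup∘updateAt′ j q j≢q ν) grown))

  domSeq-Invariant : ∀ k → size la + k ≤ size Λ → Σ (Vec ℕ m) λ ν → domSeq h la k ≡ just ν × Invariant k ν
  domSeq-Invariant zero _ =
    la , refl , (la-partition , (λ _ → ≤-refl) , (λ _ → m≤m+n _ _)) ,
    (λ _ _ _ la<la → ⊥-elim (<-irrefl refl la<la)) , sym (+-identityʳ _)
  domSeq-Invariant (suc k) ≤Λ with domSeq-Invariant k (≤-trans (+-monoʳ-≤ (size la) (n≤1+n k)) ≤Λ)
  ... | ν , ν-seq , ν-inv@(_ , _ , ν-size)
    with step ν-inv (subst (_< size Λ) (sym ν-size) (subst (_≤ size Λ) (+-suc (size la) k) ≤Λ))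
  ... | ν' , ν'-step , ν'-inv = ν' , trans (cong (_>>= domStep h la) ν-seq) ν'-step , ν'-inv

  -- Either some row j' ≥ j has grown, and then rows above j are full; or rows from j on
  -- are those of λ, and then the remaining parts of μ can only be larger.
  FullAbove⇒psum≥ : ∀ {ν} → Bounded h la ν → FullAbove la Λ ν → ∀ μ → Bounded h la μ →
    size μ ≡ size ν → ∀ j → psum j μ ≤ psum j ν
  FullAbove⇒psum≥ {ν} ν-bounded ν-full μ μ-bounded μ≡ν j
    with any? (λ r → (j ≤? toℕ r) ×-dec (lookup la r <? lookup ν r))
  ... | yes (r , j≤r , grown) =
    psum-mono j μ ν λ i i<j →
      subst (lookup μ i ≤_) (sym (ν-full i r (<-≤-trans i<j j≤r) grown)) (⊆Λ μ μ-bounded i)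
  ... | no none = +-cancelʳ-≤ (tailSum j μ) _ _ (begin
    psum j μ + tailSum j μ  ≡⟨ psum+tailSum j μ ⟩
    size μ                  ≡⟨ μ≡ν ⟩
    size ν                  ≡⟨ psum+tailSum j ν ⟨
    psum j ν + tailSum j ν  ≤⟨ +-monoʳ-≤ (psum j ν) (tailSum-mono j ν μ ν≤μ) ⟩
    psum j ν + tailSum j μ  ∎)
    where
    open ≤-Reasoning
    ν≤μ : ∀ i → j ≤ toℕ i → lookup ν i ≤ lookup μ i
    ν≤μ i j≤i = ≤-trans (≮⇒≥ (λ grown → none (i , j≤i , grown))) (proj₁ (proj₂ μ-bounded) i)

  domSeq-dominates : ∀ k → size la + k ≤ size Λ → Σ (Vec ℕ m) λ ν → domSeq h la k ≡ just ν ×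
    ((μ : Vec ℕ m) → Bounded h la μ → size μ ≡ size la + k → Dominates ν μ)
  domSeq-dominates k ≤Λ with domSeq-Invariant k ≤Λ
  ... | ν , ν-seq , ν-bounded , ν-full , ν-size =
    ν , ν-seq , λ μ μ-bounded μ-size →
      trans ν-size (sym μ-size) , FullAbove⇒psum≥ ν-bounded ν-full μ μ-bounded (trans μ-size (sym ν-size))

  domSeq-greatest : ∀ N → size la + N ≡ size Λ → domSeq h la N ≡ just Λ
  domSeq-greatest N ≡Λ with domSeq-Invariant N (≤-reflexive ≡Λ)
  ... | ν , ν-seq , ν-bounded , _ , ν-size =
    trans ν-seq (cong just (⊆ᵖ∧size≥⇒≡ ν Λ (⊆Λ ν ν-bounded) (≤-reflexive (trans (sym ≡Λ) (sym ν-size)))))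

indicator : Bool → ℕ
indicator b = if b then 1 else 0

count-∷ : ∀ {X : Set} (p : X → Bool) x xs → count p (x ∷ xs) ≡ indicator (p x) + count p xs
count-∷ p x xs with p x
... | true  = refl
... | false = refl

size-tabulate-+ : ∀ {n} (f g : Fin n → ℕ) →
  size (V.tabulate (λ j → f j + g j)) ≡ size (V.tabulate f) + size (V.tabulate g)
size-tabulate-+ {zero}  f g = refl
size-tabulate-+ {suc n} f g =
  trans (cong (f zero + g zero +_) (size-tabulate-+ (f ∘ suc) (g ∘ suc))) (interchange (f zero) (g zero) _ _)

size-tabulate-0 : ∀ n → size (V.tabulate {n = n} λ _ → 0) ≡ 0
size-tabulate-0 zero    = refl
size-tabulate-0 (suc n) = size-tabulate-0 n

size-indicator : ∀ n v → 1 ≤ v → v ≤ n → size (V.tabulate {n = n} λ j → indicator (v ≡ᵇ suc (toℕ j))) ≡ 1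
size-indicator (suc n) 1             _ _         = cong suc (size-tabulate-0 n)
size-indicator (suc n) (suc (suc v)) _ (s≤s v<n) = size-indicator n (suc v) (s≤s z≤n) v<n

size-content : ∀ {m} (T′ : List (Box × ℕ)) → (∀ {e} → e ∈ T′ → 1 ≤ proj₂ e × proj₂ e ≤ m) →
  size (content {m} T′) ≡ length T′
size-content {m} []       _     = size-tabulate-0 m
size-content {m} (e ∷ T′) entries = begin
  size (content {m} (e ∷ T′))
    ≡⟨ cong size (VP.tabulate-cong λ j → count-∷ (isEntry j) e T′) ⟩
  size (V.tabulate λ j → indicator (isEntry j e) + count (isEntry j) T′)
    ≡⟨ size-tabulate-+ (λ j → indicator (isEntry j e)) _ ⟩
  size (V.tabulate λ j → indicator (isEntry j e)) + size (content {m} T′)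
    ≡⟨ cong₂ _+_ (size-indicator m (proj₂ e) 1≤e e≤m) (size-content T′ (entries ∘ there)) ⟩
  suc (length T′)
    ∎
  where
  open ≡-Reasoning
  isEntry : Fin m → Box × ℕ → Bool
  isEntry j e = proj₂ e ≡ᵇ suc (toℕ j)
  1≤e = proj₁ (entries (here refl))
  e≤m = proj₂ (entries (here refl))

length-concatMap : ∀ {X Y : Set} (f : X → List Y) xs → length (concatMap f xs) ≡ NL.sum (map (length ∘ f) xs)
length-concatMap f []       = refl
length-concatMap f (x ∷ xs) = trans (LP.length-++ (f x)) (cong (length (f x) +_) (length-concatMap f xs))

sum-tabulate : ∀ {n} (μ : Vec ℕ n) (f : Fin n → ℕ) → (∀ i → f i ≡ lookup μ i) → NL.sum (L.tabulate f) ≡ size μ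
sum-tabulate []       f f≡ = refl
sum-tabulate (x ∷ xs) f f≡ = cong₂ _+_ (f≡ zero) (sum-tabulate xs (f ∘ suc) (f≡ ∘ suc))

youngBoxes : ∀ {m} → Vec ℕ m → List Box
youngBoxes μ = rowsBoxes (λ _ → 0) (lookup μ)

length-youngBoxes : ∀ {m} (μ : Vec ℕ m) → length (youngBoxes μ) ≡ size μ
length-youngBoxes {m} μ = begin
  length (youngBoxes μ)                     ≡⟨ length-concatMap row (allFin m) ⟩
  NL.sum (map (length ∘ row) (allFin m))    ≡⟨ cong NL.sum (LP.map-tabulate (λ i → i) (length ∘ row)) ⟩
  NL.sum (L.tabulate (length ∘ row))        ≡⟨ sum-tabulate μ (length ∘ row) length-row ⟩
  size μ                                    ∎
  where
  open ≡-Reasoning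
  row : Fin m → List Box
  row i = map (toℕ i ,_) (range 0 (lookup μ i))
  length-row : ∀ i → length (row i) ≡ lookup μ i
  length-row i = trans (LP.length-map (toℕ i ,_) (range 0 (lookup μ i)))
                  (trans (LP.length-map (0 +_) (upTo (lookup μ i))) (LP.length-upTo (lookup μ i)))

module _ {m} (μ : Vec ℕ m) where

  IsTableau : List (Box × ℕ) → Set
  IsTableau T′ = T′ ∈ assignAll (youngBoxes μ) (λ _ → range 1 (suc m)) × T (allPairs T′ ssytOK)

  ∈-ssyt⁻ : ∀ {T′} → T′ ∈ ssyt μ → IsTableau T′
  ∈-ssyt⁻ = ∈-filter⁻ (λ T′ → T? (allPairs T′ ssytOK))

  IsTableau⇒size-content : ∀ {T′} → IsTableau T′ → size (content {m} T′) ≡ size μ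
  IsTableau⇒size-content {T′} (assigned , _) with ∈-assignAll⁻ (λ _ → range 1 (suc m)) (youngBoxes μ) assigned
  ... | boxes , entries = begin
    size (content {m} T′)     ≡⟨ size-content T′ (λ e∈ → map₂ s≤s⁻¹ (∈-range⁻ (entries e∈))) ⟩
    length T′                 ≡⟨ LP.length-map proj₁ T′ ⟨
    length (map proj₁ T′)     ≡⟨ cong length boxes ⟩
    length (youngBoxes μ)     ≡⟨ length-youngBoxes μ ⟩
    size μ                    ∎
    where open ≡-Reasoning

  rowTableau : List (Box × ℕ)
  rowTableau = map (λ x → (x , suc (proj₁ x))) (youngBoxes μ)

  rowTableau-IsTableau : IsTableau rowTableau
  rowTableau-IsTableau = ∈-assignAll⁺ (λ _ → range 1 (suc m)) (youngBoxes μ) (suc ∘ proj₁) valid ,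
                         allPairs⁺ ssytOK rowTableau semistandard
    where
    valid : ∀ {x} → x ∈ youngBoxes μ → suc (proj₁ x) ∈ range 1 (suc m)
    valid x∈ with ∈-rowsBoxes⁻ (λ _ → 0) (lookup μ) x∈
    ... | i , refl , _ = ∈-range⁺ (s≤s z≤n) (s≤s (toℕ<n i))
    semistandard : ∀ {x y} → x ∈ rowTableau → y ∈ rowTableau → T (ssytOK x y)
    semistandard x∈ y∈ with ∈-map⁻ (λ x → (x , suc (proj₁ x))) x∈ | ∈-map⁻ (λ x → (x , suc (proj₁ x))) y∈
    ... | (r , c) , _ , refl | (r' , c') , _ , refl =
      from T-∧ ( ⇒ᵇ-intro (λ t → ≤⇒≤ᵇ (s≤s (≤-reflexive (≡ᵇ⇒≡ r r' (proj₁ (to T-∧ t))))))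
               , ⇒ᵇ-intro (λ t → proj₂ (to (T-∧ {c ≡ᵇ c'}) t)))

vecEqᵇ⇒≡ : ∀ {n} (u v : Vec ℕ n) → T (vecEqᵇ u v) → u ≡ v
vecEqᵇ⇒≡ []       []       _ = refl
vecEqᵇ⇒≡ (x ∷ xs) (y ∷ ys) t with to T-∧ t
... | x≡ᵇy , xs≡ᵇys = cong₂ _∷_ (≡ᵇ⇒≡ x y x≡ᵇy) (vecEqᵇ⇒≡ xs ys xs≡ᵇys)

vecEqᵇ-refl : ∀ {n} (u : Vec ℕ n) → T (vecEqᵇ u u)
vecEqᵇ-refl []       = tt
vecEqᵇ-refl (x ∷ xs) = from T-∧ (≡⇒≡ᵇ x x refl , vecEqᵇ-refl xs)

module _ {X : Set} (p : X → Bool) where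

  count≢0⇒∃ : ∀ xs → count p xs ≢ 0 → ∃ λ x → x ∈ xs × T (p x)
  count≢0⇒∃ xs count≢0 with length≢0⇒∃∈ _ count≢0
  ... | x , x∈ = x , ∈-filter⁻ (T? ∘ p) {xs = xs} x∈

  ∈∧T⇒count≢0 : ∀ {xs x} → x ∈ xs → T (p x) → count p xs ≢ 0
  ∈∧T⇒count≢0 x∈ px = ∈⇒length≢0 (∈-filter⁺ (T? ∘ p) x∈ px)

schurCoeff≢0⇒size≡ : ∀ {m} (μ α : Vec ℕ m) → schurCoeff μ α ≢ 0 → size μ ≡ size α
schurCoeff≢0⇒size≡ μ α K≢0 with count≢0⇒∃ (λ T′ → vecEqᵇ (content T′) α) (ssyt μ) K≢0
... | T′ , T′∈ , content≡ᵇα =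
  trans (sym (IsTableau⇒size-content μ (∈-ssyt⁻ μ T′∈))) (cong size (vecEqᵇ⇒≡ (content T′) α content≡ᵇα))

schurCoeff-content≢0 : ∀ {m} (μ : Vec ℕ m) {T′} → IsTableau μ T′ → schurCoeff μ (content {m} T′) ≢ 0
schurCoeff-content≢0 {m} μ {T′} (assigned , semistandard) =
  ∈∧T⇒count≢0 (λ T″ → vecEqᵇ (content T″) (content {m} T′))
    (∈-filter⁺ (λ T″ → T? (allPairs T″ ssytOK)) assigned semistandard) (vecEqᵇ-refl (content {m} T′))

isPartitionᵇ⇒IsPartition : ∀ {n} (v : Vec ℕ n) → T (isPartitionᵇ v) → IsPartition v
isPartitionᵇ⇒IsPartition []           _ = λ ()
isPartitionᵇ⇒IsPartition (x ∷ [])     _ = λ { zero zero _ → ≤-refl }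
isPartitionᵇ⇒IsPartition (x ∷ y ∷ ys) t =
  let tail-partition = isPartitionᵇ⇒IsPartition (y ∷ ys) (proj₂ (to (T-∧ {y ≤ᵇ x}) t)) in
  IsPartition-∷ tail-partition (λ k → ≤-trans (tail-partition zero k z≤n) (≤ᵇ⇒≤ y x (proj₁ (to T-∧ t))))

IsPartition⇒isPartitionᵇ : ∀ {n} (v : Vec ℕ n) → IsPartition v → T (isPartitionᵇ v)
IsPartition⇒isPartitionᵇ []           _ = tt
IsPartition⇒isPartitionᵇ (x ∷ [])     _ = tt
IsPartition⇒isPartitionᵇ (x ∷ y ∷ ys) P =
  from T-∧ (≤⇒≤ᵇ (P zero (suc zero) z≤n) , IsPartition⇒isPartitionᵇ (y ∷ ys) (IsPartition-tail P))

Between : ∀ {n} → Vec ℕ n → Vec ℕ n → Vec ℕ n → Set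
Between l u μ = ∀ i → lookup l i ≤ lookup μ i × lookup μ i ≤ lookup u i

∈-vecsBetween⁻ : ∀ {n} (l u μ : Vec ℕ n) → μ ∈ vecsBetween l u → Between l u μ
∈-vecsBetween⁻ (l ∷ ls) (u ∷ us) μ μ∈
  with find (∈-concatMap⁻ (λ x → map (x ∷_) (vecsBetween ls us)) {xs = range l (suc u)} μ∈)
... | x , x∈ , μ∈row with ∈-map⁻ (x ∷_) μ∈row
... | v , v∈ , refl = λ where
  zero    → map₂ s≤s⁻¹ (∈-range⁻ x∈)
  (suc i) → ∈-vecsBetween⁻ ls us v v∈ i

∈-vecsBetween⁺ : ∀ {n} (l u μ : Vec ℕ n) → Between l u μ → μ ∈ vecsBetween l u
∈-vecsBetween⁺ []       []       []       _  = here refl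
∈-vecsBetween⁺ (l ∷ ls) (u ∷ us) (x ∷ xs) between =
  ∈-concatMap⁺ (λ x → map (x ∷_) (vecsBetween ls us))
    (lose (∈-range⁺ (proj₁ (between zero)) (s≤s (proj₂ (between zero))))
          (∈-map⁺ (x ∷_) (∈-vecsBetween⁺ ls us xs (between ∘ suc))))

module _ {m} (h : ℕ) (la : Vec ℕ m) where

  private
    upper : Vec ℕ m
    upper = V.tabulate λ i → lookup la i + h * toℕ i

  ∈-candidates⁻ : ∀ {μ} → μ ∈ candidates h la → Bounded h la μ
  ∈-candidates⁻ {μ} μ∈ with ∈-filter⁻ (T? ∘ isPartitionᵇ) {xs = vecsBetween la upper} μ∈
  ... | μ∈box , partition =
    isPartitionᵇ⇒IsPartition μ partition ,
    (λ i → proj₁ (∈-vecsBetween⁻ la upper μ μ∈box i)) ,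
    (λ i → subst (lookup μ i ≤_) (VP.lookup∘tabulate _ i) (proj₂ (∈-vecsBetween⁻ la upper μ μ∈box i)))

  ∈-candidates⁺ : ∀ {μ} → Bounded h la μ → μ ∈ candidates h la
  ∈-candidates⁺ {μ} (μ-partition , la⊆μ , μ-bound) =
    ∈-filter⁺ (T? ∘ isPartitionᵇ)
      (∈-vecsBetween⁺ la upper μ λ i → la⊆μ i , subst (lookup μ i ≤_) (sym (VP.lookup∘tabulate _ i)) (μ-bound i))
      (IsPartition⇒isPartitionᵇ μ μ-partition)

∣sgn∣≡1 : ∀ n → Z.∣ sgn n ∣ ≡ 1
∣sgn∣≡1 zero    = refl
∣sgn∣≡1 (suc n) = trans (ZP.∣-i∣≡∣i∣ (sgn n)) (∣sgn∣≡1 n)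

sgn*≡0⇒≡0 : ∀ n x → sgn n Z.* x ≡ ⁺ 0 → x ≡ ⁺ 0
sgn*≡0⇒≡0 n x sgn*x≡0 = ZP.∣i∣≡0⇒i≡0 (begin
  Z.∣ x ∣                  ≡⟨ *-identityˡ Z.∣ x ∣ ⟨
  1 * Z.∣ x ∣              ≡⟨ cong (_* Z.∣ x ∣) (∣sgn∣≡1 n) ⟨
  Z.∣ sgn n ∣ * Z.∣ x ∣    ≡⟨ ZP.abs-* (sgn n) x ⟨
  Z.∣ sgn n Z.* x ∣        ≡⟨ cong Z.∣_∣ sgn*x≡0 ⟩
  0                        ∎)
  where open ≡-Reasoning

module _ {X : Set} (f : X → ℤ) where

  sumℤ : List X → ℤ
  sumℤ xs = foldr Z._+_ (⁺ 0) (map f xs)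

  sumℤ≢0⇒∃ : ∀ xs → sumℤ xs ≢ ⁺ 0 → ∃ λ x → x ∈ xs × f x ≢ ⁺ 0
  sumℤ≢0⇒∃ []       sum≢0 = ⊥-elim (sum≢0 refl)
  sumℤ≢0⇒∃ (x ∷ xs) sum≢0 with f x ZP.≟ ⁺ 0
  ... | no fx≢0  = x , here refl , fx≢0
  ... | yes fx≡0 with sumℤ≢0⇒∃ xs (λ rest≡0 → sum≢0 (cong₂ Z._+_ fx≡0 rest≡0))
  ...   | y , y∈ , fy≢0 = y , there y∈ , fy≢0

  sumℤ-factor : ∀ s (g : X → ℕ) xs → (∀ {x} → x ∈ xs → f x ≡ s Z.* ⁺ g x) →
    sumℤ xs ≡ s Z.* ⁺ NL.sum (map g xs)
  sumℤ-factor s g []       _   = sym (ZP.*-zeroʳ s)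
  sumℤ-factor s g (x ∷ xs) f≡ = begin
    f x Z.+ sumℤ xs                                ≡⟨ cong₂ Z._+_ (f≡ (here refl)) (sumℤ-factor s g xs (f≡ ∘ there)) ⟩
    s Z.* ⁺ g x Z.+ s Z.* ⁺ NL.sum (map g xs)      ≡⟨ ZP.*-distribˡ-+ s (⁺ g x) _ ⟨
    s Z.* (⁺ g x Z.+ ⁺ NL.sum (map g xs))          ≡⟨ cong (s Z.*_) (ZP.pos-+ (g x) _) ⟨
    s Z.* ⁺ NL.sum (map g (x ∷ xs))                ∎
    where open ≡-Reasoning

∈⇒≤sum : ∀ {X : Set} (g : X → ℕ) {xs x} → x ∈ xs → g x ≤ NL.sum (map g xs)
∈⇒≤sum g           (here refl) = m≤m+n _ _
∈⇒≤sum g {y ∷ _}   (there x∈)  = ≤-trans (∈⇒≤sum g x∈) (m≤n+m _ (g y))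

module Degree {m} (h : ℕ) (h≥1 : 1 ≤ h) (la Λ : Vec ℕ m) (Λ-greatest : IsGreatest h la Λ) where

  private
    signedB : Vec ℕ m → ℤ
    signedB μ = sgn (size μ ∸ size la) Z.* ⁺ b h la μ

    term : Vec ℕ m → Vec ℕ m → ℤ
    term α μ = signedB μ Z.* ⁺ schurCoeff μ α

    schurCoeff≢0 : ∀ α μ → term α μ ≢ ⁺ 0 → schurCoeff μ α ≢ 0
    schurCoeff≢0 α μ term≢0 K≡0 = term≢0 (trans (cong (λ K → signedB μ Z.* ⁺ K) K≡0) (ZP.*-zeroʳ (signedB μ)))

  GCoeff≢0⇒size≤ : ∀ α → GCoeff h la α ≢ ⁺ 0 → size α ≤ size Λ
  GCoeff≢0⇒size≤ α G≢0 with sumℤ≢0⇒∃ (term α) (candidates h la) G≢0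
  ... | μ , μ∈ , term≢0 = begin
    size α  ≡⟨ schurCoeff≢0⇒size≡ μ α (schurCoeff≢0 α μ term≢0) ⟨
    size μ  ≤⟨ size-mono-⊆ᵖ μ Λ (proj₂ Λ-greatest μ (∈-candidates⁻ h la μ∈)) ⟩
    size Λ  ∎
    where open ≤-Reasoning

  -- this is Λ, but only its size is needed
  topContent : Vec ℕ m
  topContent = content (rowTableau Λ)

  size-topContent : size topContent ≡ size Λ
  size-topContent = IsTableau⇒size-content Λ (rowTableau-IsTableau Λ)

  -- every μ contributing to the coefficient of x^topContent has |μ| = |Λ|, so all
  -- contributions carry the same sign, and Λ itself contributes
  GCoeff-topContent≢0 : GCoeff h la topContent ≢ ⁺ 0
  GCoeff-topContent≢0 G≡0 = <⇒≢ sum>0 (sym (ZP.+-injective (sgn*≡0⇒≡0 (size Λ ∸ size la) _ sum≡0)))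
    where
    s = sgn (size Λ ∸ size la)
    weight : Vec ℕ m → ℕ
    weight μ = b h la μ * schurCoeff μ topContent
    term≡ : ∀ μ → term topContent μ ≡ s Z.* ⁺ weight μ
    term≡ μ with schurCoeff μ topContent in K
    ... | zero  = begin
      signedB μ Z.* ⁺ 0        ≡⟨ ZP.*-zeroʳ (signedB μ) ⟩
      ⁺ 0                      ≡⟨ ZP.*-zeroʳ s ⟨
      s Z.* ⁺ 0                ≡⟨ cong (λ n → s Z.* ⁺ n) (*-zeroʳ (b h la μ)) ⟨
      s Z.* ⁺ (b h la μ * 0)   ∎
      where open ≡-Reasoning
    ... | suc k = begin
      signedB μ Z.* ⁺ suc k                             ≡⟨ cong (λ n → sgn (n ∸ size la) Z.* ⁺ b h la μ Z.* ⁺ suc k) size-μ ⟩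
      s Z.* ⁺ b h la μ Z.* ⁺ suc k                      ≡⟨ ZP.*-assoc s (⁺ b h la μ) (⁺ suc k) ⟩
      s Z.* (⁺ b h la μ Z.* ⁺ suc k)                    ≡⟨ cong (s Z.*_) (ZP.pos-* (b h la μ) (suc k)) ⟨
      s Z.* ⁺ (b h la μ * suc k)                        ∎
      where
      open ≡-Reasoning
      size-μ : size μ ≡ size Λ
      size-μ = trans (schurCoeff≢0⇒size≡ μ topContent (λ K≡0 → 1+n≢0 (trans (sym K) K≡0))) size-topContent
    sum≡0 : s Z.* ⁺ NL.sum (map weight (candidates h la)) ≡ ⁺ 0
    sum≡0 = trans (sym (sumℤ-factor (term topContent) s weight (candidates h la) (λ {μ} _ → term≡ μ))) G≡0
    sum>0 : 0 < NL.sum (map weight (candidates h la))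
    sum>0 = <-≤-trans
      (*-mono-≤ {1} {b h la Λ} (n≢0⇒n>0 (proj₂ (proj₂ (from (A⇔Bounded h h≥1 la Λ) (proj₁ Λ-greatest)))))
                (n≢0⇒n>0 (schurCoeff-content≢0 Λ (rowTableau-IsTableau Λ))))
      (∈⇒≤sum weight {candidates h la} (∈-candidates⁺ h la {Λ} (proj₁ Λ-greatest)))

  DegG⇒≡size : ∀ d → DegG h la d → d ≡ size Λ
  DegG⇒≡size d ((α , G≢0 , size-α) , ≤d) =
    ≤-antisym (subst (_≤ size Λ) size-α (GCoeff≢0⇒size≤ α G≢0))
              (subst (_≤ d) size-topContent (≤d topContent GCoeff-topContent≢0))

Bounded⇔⊆greatest : ∀ {m} h (la Λ : Vec ℕ m) → IsGreatest h la Λ → ∀ μ →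
  Bounded h la μ ⇔ (IsPartition μ × la ⊆ᵖ μ × μ ⊆ᵖ Λ)
Bounded⇔⊆greatest h la Λ (Λ-bounded , ⊆Λ) μ = mk⇔
  (λ μ-bounded@(μ-partition , la⊆μ , _) → μ-partition , la⊆μ , ⊆Λ μ μ-bounded)
  (λ (μ-partition , la⊆μ , μ⊆Λ) → μ-partition , la⊆μ , λ i → ≤-trans (μ⊆Λ i) (proj₂ (proj₂ Λ-bounded) i))

lemma3p8 : (m : ℕ) → 1 ≤ m → (h : ℕ) → 1 ≤ h → (la : Vec ℕ m) → IsPartition la →
    (N : ℕ) → DegG h la (size la + N) →
    -- (a) λ^(k) exists for k ≤ N and dominates every μ ∈ A(h,λ) of size |λ|+k
    ((k : ℕ) → k ≤ N → Σ (Vec ℕ m) λ ν → domSeq h la k ≡ just ν ×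
        ((μ : Vec ℕ m) → A h la μ → size μ ≡ size la + k → Dominates ν μ))
    -- (b) λ^(N) is the unique partition of |λ|+N in A(h,λ)
    × Σ (Vec ℕ m) (λ ν → domSeq h la N ≡ just ν × A h la ν × size ν ≡ size la + N ×
        ((μ : Vec ℕ m) → A h la μ → size μ ≡ size la + N → μ ≡ ν)
    -- (c) A(h,λ) = { μ partition with at most m parts | λ ⊆ μ ⊆ λ^(N) }
      × ((μ : Vec ℕ m) → A h la μ ⇔ (IsPartition μ × la ⊆ᵖ μ × μ ⊆ᵖ ν)))
lemma3p8 m _ h h≥1 la la-partition N deg =
  dominates ,
  Λ , domSeq-greatest N size-Λ , from (A⇔ Λ) (proj₁ Λ-greatest) , sym size-Λ , unique ,
  λ μ → ⇔-trans (A⇔ μ) (Bounded⇔⊆greatest h la Λ Λ-greatest μ)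
  where
  Λ = greatestBounded h la
  Λ-greatest = greatestBounded-isGreatest h la la-partition
  open DominatingSequence h la la-partition Λ Λ-greatest

  A⇔ : ∀ μ → A h la μ ⇔ Bounded h la μ
  A⇔ = A⇔Bounded h h≥1 la

  size-Λ : size la + N ≡ size Λ
  size-Λ = Degree.DegG⇒≡size h h≥1 la Λ Λ-greatest (size la + N) deg

  dominates : ∀ k → k ≤ N → Σ (Vec ℕ m) λ ν → domSeq h la k ≡ just ν ×
    ((μ : Vec ℕ m) → A h la μ → size μ ≡ size la + k → Dominates ν μ)
  dominates k k≤N =
    let ν , ν-seq , ν-dominates = domSeq-dominates k (subst (size la + k ≤_) size-Λ (+-monoʳ-≤ (size la) k≤N))
    in ν , ν-seq , λ μ → ν-dominates μ ∘ to (A⇔ μ)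

  unique : ∀ μ → A h la μ → size μ ≡ size la + N → μ ≡ Λ
  unique μ μ∈A μ-size =
    ⊆ᵖ∧size≥⇒≡ μ Λ (proj₂ Λ-greatest μ (to (A⇔ μ) μ∈A)) (≤-reflexive (trans (sym size-Λ) (sym μ-size)))
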